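{- Let $G$ be a finite connected multigraph, let $H$ be a refinement of $G$, let $T$ be a tree and let $\phi\colon H\to T$ be a finite harmonic morphism with $\deg(\phi)=\operatorname{sgon}(G)$. Let $v'\in V(T)$ be a leaf of $T$ such that every vertex $v\in V(H)$ with $\phi(v)=v'$ is an external added vertex. Let $T'=T\setminus\{v'\}$. Then there exist a refinement $H'$ of $G$ and a transformation $\phi'\colon H'\to T'$ of $\phi$.
   Context: Graphs are finite, connected, and may have multiple edges and loops. A refinement $H$ of $G$ is a graph obtained from $G$ by subdividing edges and attaching trees to vertices. The vertices of $H$ not in $V(G)$ are added vertices; those lying on a subdivided edge of $G$ are internal added vertices, and the others (those in attached trees) are external added vertices. A morphism $\phi\colon H\to T$ is finite if it maps vertices to vertices and every edge $xy$ to the edge $\phi(x)\phi(y)$, and each edge $e$ carries a positive integer index $r_\phi(e)$. It is harmonic if for every vertex $x$ of $H$ the sum $\sum r_\phi(e)$ over edges $e$ at $x$ mapped to a given edge $e'$ at $\phi(x)$ is independent of $e'$. The degree $\deg(\phi)=\sum_{e\mapsto e'}r_\phi(e)$ is independent of the edge $e'$ of $T$. The stable gonality $\operatorname{sgon}(G)$ is the minimum degree of a finite harmonic morphism from a refinement of $G$ to a tree. A transformation of $\phi\colon H\to T$ is a finite harmonic morphism $\phi'\colon H'\to T'$ from a refinement $H'$ of $G$ to a tree $T'$ with $\deg(\phi')\le\deg(\phi)$. -}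

module Defs where

open import Data.Nat using (ℕ; zero; suc; _+_; _≤_; _<_)
open import Data.Fin using (Fin; zero; suc)
open import Data.Fin.Properties using (_≟_)
open import Data.Bool using (Bool; true; false; if_then_else_; _∨_; _∧_)
open import Data.List using (List; []; _∷_)
open import Data.List.Relation.Unary.Unique.Propositional using (Unique)
open import Data.Product using (Σ; ∃; _×_; _,_)
open import Data.Sum using (_⊎_)
open import Relation.Nullary using (does; ¬_)
open import Relation.Binary.PropositionalEquality using (_≡_; _≢_)

-- Vertices are Fin nV, edges are Fin nE; edge e joins src e and tgt e
-- (the orientation carries no meaning; all notions below are symmetric).

record Graph : Set where
  constructor mkGraph
  field
    nV  : ℕ
    nE  : ℕ
    src : Fin nE → Fin nV
    tgt : Fin nE → Fin nV

open Graph public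

_==_ : ∀ {n} → Fin n → Fin n → Bool
a == b = does (a ≟ b)

Joins : (G : Graph) → Fin (nE G) → Fin (nV G) → Fin (nV G) → Set
Joins G e x y = (src G e ≡ x × tgt G e ≡ y) ⊎ (src G e ≡ y × tgt G e ≡ x)

Incident : (G : Graph) → Fin (nE G) → Fin (nV G) → Set
Incident G e x = (src G e ≡ x) ⊎ (tgt G e ≡ x)

incident? : (G : Graph) → Fin (nE G) → Fin (nV G) → Bool
incident? G e x = (src G e == x) ∨ (tgt G e == x)

data Walk (G : Graph) : Fin (nV G) → Fin (nV G) → List (Fin (nE G)) → Set where
  nil  : ∀ {x} → Walk G x x []
  cons : ∀ {x y z es} (e : Fin (nE G)) → Joins G e x y → Walk G y z es → Walk G x z (e ∷ es)

IsConnected : Graph → Set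
IsConnected G = (0 < nV G) × (∀ x y → ∃ λ es → Walk G x y es)

IsAcyclic : Graph → Set
IsAcyclic G = ∀ x es → Walk G x x es → Unique es → es ≡ []

IsTree : Graph → Set
IsTree T = IsConnected T × IsAcyclic T

IsLeaf : (T : Graph) → Fin (nV T) → Set
IsLeaf T v = Σ (Fin (nE T)) λ e → Incident T e v × ¬ (src T e ≡ tgt T e)
               × (∀ e' → Incident T e' v → e' ≡ e)

data VKind : Set where
  original internal external : VKind

-- A graph with vertex kinds and a flag on each edge: true iff the edge
-- is (a piece of) a subdivided edge of the original graph.
record LGraph : Set where
  constructor mkLGraph
  field
    graph  : Graph
    vkind  : Fin (nV graph) → VKind
    onGEdge : Fin (nE graph) → Bool

open LGraph public

baseL : Graph → LGraph
baseL G = mkLGraph G (λ _ → original) (λ _ → true)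

-- subdivide edge e: new vertex zero, edge e becomes (src e, new),
-- new edge zero becomes (new, tgt e); old items are shifted by suc.
subdivideL : (L : LGraph) → Fin (nE (graph L)) → LGraph
subdivideL (mkLGraph (mkGraph n m s t) k g) e =
  mkLGraph (mkGraph (suc n) (suc m) s' t') k' g'
  where
  s' : Fin (suc m) → Fin (suc n)
  s' zero     = zero
  s' (suc e₂) = suc (s e₂)
  t' : Fin (suc m) → Fin (suc n)
  t' zero     = suc (t e)
  t' (suc e₂) = if e₂ == e then zero else suc (t e₂)
  k' : Fin (suc n) → VKind
  k' zero    = if g e then internal else external
  k' (suc x) = k x
  g' : Fin (suc m) → Bool
  g' zero     = g e
  g' (suc e₂) = g e₂

-- attach a new leaf zero at vertex u by a new edge zero = (u, new)
attachL : (L : LGraph) → Fin (nV (graph L)) → LGraph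
attachL (mkLGraph (mkGraph n m s t) k g) u =
  mkLGraph (mkGraph (suc n) (suc m) s' t') k' g'
  where
  s' : Fin (suc m) → Fin (suc n)
  s' zero     = suc u
  s' (suc e₂) = suc (s e₂)
  t' : Fin (suc m) → Fin (suc n)
  t' zero     = zero
  t' (suc e₂) = suc (t e₂)
  k' : Fin (suc n) → VKind
  k' zero    = external
  k' (suc x) = k x
  g' : Fin (suc m) → Bool
  g' zero     = false
  g' (suc e₂) = g e₂

-- L is a refinement of G (subdividing edges, attaching trees = attaching
-- leaves repeatedly)
data Refines (G : Graph) : LGraph → Set where
  base   : Refines G (baseL G)
  subdiv : ∀ {L} → Refines G L → (e : Fin (nE (graph L))) → Refines G (subdivideL L e)
  attach : ∀ {L} → Refines G L → (u : Fin (nV (graph L))) → Refines G (attachL L u)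

sumFin : (n : ℕ) → (Fin n → ℕ) → ℕ
sumFin zero    f = 0
sumFin (suc n) f = f zero + sumFin n (λ i → f (suc i))

record FHM (H T : Graph) : Set where
  field
    φV : Fin (nV H) → Fin (nV T)
    φE : Fin (nE H) → Fin (nE T)
    r  : Fin (nE H) → ℕ
    r-pos : ∀ e → 0 < r e
    -- finite: the edge xy goes to the edge φ(x)φ(y)
    preserves : ∀ e → Joins T (φE e) (φV (src H e)) (φV (tgt H e))
    surjective : ∀ y → ∃ λ x → φV x ≡ y

open FHM public

mult : ∀ {H T} → FHM H T → Fin (nV H) → Fin (nE T) → ℕ
mult {H} φ x e' = sumFin (nE H) λ e →
  if incident? H e x ∧ (φE φ e == e') then r φ e else 0

IsHarmonic : ∀ {H T} → FHM H T → Set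
IsHarmonic {H} {T} φ = ∀ x e' e'' → Incident T e' (φV φ x) → Incident T e'' (φV φ x)
                         → mult φ x e' ≡ mult φ x e''

preSum : ∀ {H T} → FHM H T → Fin (nE T) → ℕ
preSum {H} φ e' = sumFin (nE H) λ e → if φE φ e == e' then r φ e else 0

degAux : (k : ℕ) → (Fin k → ℕ) → ℕ → ℕ
degAux zero    f n = n
degAux (suc k) f n = f zero

-- degree: computed at the edge zero of T; if T has no edges, the number
-- of vertices of H (which is 1 for connected H)
degree : ∀ {H T} → FHM H T → ℕ
degree {H} {T} φ = degAux (nE T) (preSum φ) (nV H)

IsSgon : Graph → ℕ → Set
IsSgon G d =
  (Σ LGraph λ L → Refines G L × Σ Graph λ T → IsTree T ×
     Σ (FHM (graph L) T) λ ψ → IsHarmonic ψ × degree ψ ≡ d)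
  × (∀ L → Refines G L → ∀ T → IsTree T → (ψ : FHM (graph L) T) → IsHarmonic ψ
       → d ≤ degree ψ)

Transformation : (G : Graph) → ∀ {H T} → FHM H T → Graph → Set
Transformation G φ T' =
  Σ LGraph λ L' → Refines G L' × IsTree T' ×
    Σ (FHM (graph L') T') λ φ' → IsHarmonic φ' × degree φ' ≤ degree φ

-- T' is (isomorphic to) T with vertex v and its incident edges removed:
-- embeddings of vertices / edges of T' into T, injective, with images
-- exactly the vertices ≠ v / the edges not incident to v, respecting ends.

record DeletesVertex (T : Graph) (v : Fin (nV T)) (T' : Graph) : Set where
  field
    ιV : Fin (nV T') → Fin (nV T)
    ιE : Fin (nE T') → Fin (nE T)
    ιV-inj : ∀ x y → ιV x ≡ ιV y → x ≡ y
    ιE-inj : ∀ e f → ιE e ≡ ιE f → e ≡ f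
    ιV-avoid : ∀ x → ιV x ≢ v
    ιV-onto : ∀ y → y ≢ v → ∃ λ x → ιV x ≡ y
    ιE-avoid : ∀ e → ¬ Incident T (ιE e) v
    ιE-onto : ∀ f → ¬ Incident T f v → ∃ λ e → ιE e ≡ f
    ιE-src : ∀ e → src T (ιE e) ≡ ιV (src T' e)
    ιE-tgt : ∀ e → tgt T (ιE e) ≡ ιV (tgt T' e)

-- Let D be
-- the set of vertices over v together with everything hanging below them in the
-- attached trees of H.  Deleting D from H gives a refinement H' of G, and φ restricts
-- to φ' : H' → T' = T ∖ {v}; since every edge leaving H' ends over v, φ' has the same
-- local multiplicities as φ, so it is harmonic, surjective and deg φ' ≤ deg φ.

module Submission where

open import Defs
open import Data.Nat using (ℕ; zero; suc; _+_; _≤_; _<_; z≤n; s≤s)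
open import Data.Nat.Properties
  using (≤-trans; ≤-reflexive; <-≤-trans; +-mono-≤; m≤m+n; m≤n+m; +-identityʳ; +-0-commutativeMonoid;
         module ≤-Reasoning)
open import Data.Fin using (Fin; zero; suc; fromℕ<; lift)
open import Data.Fin.Properties using (_≟_; suc-injective; 0≢1+n; any?; lift-injective)
open import Data.Bool using (Bool; true; false; if_then_else_; _∨_; _∧_)
open import Data.Bool.Properties using (∨-zeroʳ; ∧-conicalˡ; ∧-conicalʳ; ¬-not; not-¬)
open import Data.List using (List; []; _∷_; map)
open import Data.List.Relation.Unary.All using ([])
open import Data.List.Relation.Unary.AllPairs using ([]; _∷_)
import Data.List.Relation.Unary.Unique.Propositional.Properties as Unique
open import Data.Product using (Σ; ∃; _×_; _,_; proj₁; proj₂)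
open import Data.Sum using (_⊎_; inj₁; inj₂)
open import Data.Empty using (⊥; ⊥-elim)
open import Function.Definitions using (Injective)
open import Relation.Nullary using (¬_; Dec; yes; no; ¬?)
open import Relation.Nullary.Decidable using (decidable-stable)
open import Relation.Binary.PropositionalEquality
import Algebra.Properties.CommutativeMonoid.Sum as CommutativeMonoidSum

==-refl : ∀ {n} (a : Fin n) → (a == a) ≡ true
==-refl a with a ≟ a
... | yes _   = refl
... | no a≢a = ⊥-elim (a≢a refl)

==-complete : ∀ {n} {a b : Fin n} → a ≡ b → (a == b) ≡ true
==-complete {a = a} refl = ==-refl a

==-false : ∀ {n} {a b : Fin n} → a ≢ b → (a == b) ≡ false
==-false {a = a} {b} a≢b with a ≟ b
... | yes a≡b = ⊥-elim (a≢b a≡b)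
... | no _    = refl

==-sound : ∀ {n} {a b : Fin n} → (a == b) ≡ true → a ≡ b
==-sound {a = a} {b} p with a ≟ b
... | yes a≡b = a≡b
==-sound () | no _

==-injective : ∀ {m n} (j : Fin m → Fin n) → Injective _≡_ _≡_ j → ∀ a b → (j a == j b) ≡ (a == b)
==-injective j inj a b with a ≟ b
... | yes refl = ==-refl (j a)
... | no a≢b   = ==-false (λ q → a≢b (inj q))

if-true : ∀ {A : Set} {b : Bool} {x y : A} → b ≡ true → (if b then x else y) ≡ x
if-true refl = refl

if-false : ∀ {A : Set} {b : Bool} {x y : A} → b ≡ false → (if b then x else y) ≡ y
if-false refl = refl

∨-introˡ : ∀ {a b} → a ≡ true → (a ∨ b) ≡ true
∨-introˡ refl = refl

∨-introʳ : ∀ a {b} → b ≡ true → (a ∨ b) ≡ true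
∨-introʳ a refl = ∨-zeroʳ a

∨-elim : ∀ a {b} → (a ∨ b) ≡ true → a ≡ true ⊎ b ≡ true
∨-elim true  _ = inj₁ refl
∨-elim false p = inj₂ p

if-∧-false : ∀ a b n → a ≡ false ⊎ b ≡ false → (if a ∧ b then n else 0) ≡ 0
if-∧-false false b     n _ = refl
if-∧-false true  false n _ = refl
if-∧-false true  true  n (inj₁ ())
if-∧-false true  true  n (inj₂ ())

if-positive : ∀ b n → 0 < (if b then n else 0) → b ≡ true
if-positive true n _ = refl

nested-if-zero : ∀ a b c n → a ≡ false ⊎ b ≡ false ⊎ c ≡ false
  → (if a then (if b ∧ c then n else 0) else 0) ≡ 0
nested-if-zero false b     c     n _ = refl
nested-if-zero true  false c     n _ = refl
nested-if-zero true  true  false n _ = refl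
nested-if-zero true  true  true  n (inj₁ ())
nested-if-zero true  true  true  n (inj₂ (inj₁ ()))
nested-if-zero true  true  true  n (inj₂ (inj₂ ()))

nested-if-one : ∀ {a b c} n → a ≡ true → b ≡ true → c ≡ true
  → (if a then (if b ∧ c then n else 0) else 0) ≡ n
nested-if-one n refl refl refl = refl

sum-ext : ∀ n {f g : Fin n → ℕ} → (∀ i → f i ≡ g i) → sumFin n f ≡ sumFin n g
sum-ext zero    _ = refl
sum-ext (suc n) h = cong₂ _+_ (h zero) (sum-ext n (λ i → h (suc i)))

sum-mono : ∀ n {f g : Fin n → ℕ} → (∀ i → f i ≤ g i) → sumFin n f ≤ sumFin n g
sum-mono zero    _ = z≤n
sum-mono (suc n) h = +-mono-≤ (h zero) (sum-mono n (λ i → h (suc i)))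

sum-zeros : ∀ n {f : Fin n → ℕ} → (∀ i → f i ≡ 0) → sumFin n f ≡ 0
sum-zeros zero    _ = refl
sum-zeros (suc n) h rewrite h zero = sum-zeros n (λ i → h (suc i))

sum-single : ∀ n (j : Fin n) (f : Fin n → ℕ) → (∀ i → i ≢ j → f i ≡ 0) → sumFin n f ≡ f j
sum-single (suc n) zero f h
  rewrite sum-zeros n {λ i → f (suc i)} (λ i → h (suc i) (λ ())) = +-identityʳ _
sum-single (suc n) (suc j) f h rewrite h zero (λ ()) =
  sum-single n j (λ i → f (suc i)) (λ i i≢j → h (suc i) (λ q → i≢j (suc-injective q)))

sum-term : ∀ n (j : Fin n) (f : Fin n → ℕ) → f j ≤ sumFin n f
sum-term (suc n) zero    f = m≤m+n _ _
sum-term (suc n) (suc j) f = ≤-trans (sum-term n j (λ i → f (suc i))) (m≤n+m _ _)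

sum-pos : ∀ n (f : Fin n → ℕ) → 0 < sumFin n f → ∃ λ i → 0 < f i
sum-pos (suc n) f p with f zero in eq
... | suc _ = zero , subst (0 <_) (sym eq) (s≤s z≤n)
... | zero with sum-pos n (λ i → f (suc i)) p
...   | i , q = suc i , q

sum-if : ∀ n (b : Bool) (f : Fin n → ℕ) →
  (if b then sumFin n f else 0) ≡ sumFin n (λ i → if b then f i else 0)
sum-if n true  f = refl
sum-if n false f = sym (sum-zeros n (λ _ → refl))

module ℕ-Sum = CommutativeMonoidSum +-0-commutativeMonoid

sumFin≡sum : ∀ n (f : Fin n → ℕ) → sumFin n f ≡ ℕ-Sum.sum f
sumFin≡sum zero    f = refl
sumFin≡sum (suc n) f = cong (f zero +_) (sumFin≡sum n (λ i → f (suc i)))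

sum-swap : ∀ n m (F : Fin n → Fin m → ℕ) →
  sumFin n (λ i → sumFin m (F i)) ≡ sumFin m (λ k → sumFin n (λ i → F i k))
sum-swap n m F = begin
  sumFin n (λ i → sumFin m (F i))               ≡⟨ sum-ext n (λ i → sumFin≡sum m (F i)) ⟩
  sumFin n (λ i → ℕ-Sum.sum (F i))              ≡⟨ sumFin≡sum n _ ⟩
  ℕ-Sum.sum (λ i → ℕ-Sum.sum (F i))             ≡⟨ ℕ-Sum.∑-comm F ⟩
  ℕ-Sum.sum (λ k → ℕ-Sum.sum (λ i → F i k))     ≡⟨ sym (sumFin≡sum m _) ⟩
  sumFin m (λ k → ℕ-Sum.sum (λ i → F i k))      ≡⟨ sum-ext m (λ k → sym (sumFin≡sum n (λ i → F i k))) ⟩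
  sumFin m (λ k → sumFin n (λ i → F i k))       ∎
  where open ≡-Reasoning

module Reindex {m n} (ι : Fin m → Fin n) (inj : Injective _≡_ _≡_ ι) (f : Fin n → ℕ) where

  δ : Fin m → Fin n → ℕ
  δ k i = if ι k == i then f i else 0

  row : ∀ k → sumFin n (δ k) ≡ f (ι k)
  row k = trans (sum-single n (ι k) (δ k) (λ i i≢ιk → if-false (==-false (λ q → i≢ιk (sym q)))))
                (if-true (==-refl (ι k)))

  column-hit : ∀ i k₀ → ι k₀ ≡ i → sumFin m (λ k → δ k i) ≡ f i
  column-hit i k₀ refl =
    trans (sum-single m k₀ (λ k → δ k (ι k₀)) (λ k k≢k₀ → if-false (==-false (λ q → k≢k₀ (inj q)))))
          (if-true (==-refl (ι k₀)))

  column-≤ : ∀ i → sumFin m (λ k → δ k i) ≤ f i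
  column-≤ i with any? (λ k → ι k ≟ i)
  ... | yes (k₀ , p) = ≤-reflexive (column-hit i k₀ p)
  ... | no ∄k = ≤-trans (≤-reflexive (sum-zeros m (λ k → if-false (==-false (λ q → ∄k (k , q)))))) z≤n

  total : sumFin m (λ k → f (ι k)) ≡ sumFin n (λ i → sumFin m (λ k → δ k i))
  total = trans (sym (sum-ext m row)) (sum-swap m n δ)

  reindex-≤ : sumFin m (λ k → f (ι k)) ≤ sumFin n f
  reindex-≤ = ≤-trans (≤-reflexive total) (sum-mono n column-≤)

  reindex-≡ : (∀ i → (∃ λ k → ι k ≡ i) ⊎ f i ≡ 0) → sumFin m (λ k → f (ι k)) ≡ sumFin n f
  reindex-≡ h = trans total (sum-ext n column)
    where
    column : ∀ i → sumFin m (λ k → δ k i) ≡ f i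
    column i with h i
    ... | inj₁ (k₀ , p) = column-hit i k₀ p
    ... | inj₂ fi≡0     = trans (sum-zeros m (λ k → vanish (ι k == i))) (sym fi≡0)
      where
      vanish : ∀ b → (if b then f i else 0) ≡ 0
      vanish true  = fi≡0
      vanish false = refl

joins-subst : ∀ T {e e' p p' q q'} → e ≡ e' → p ≡ p' → q ≡ q' → Joins T e p q → Joins T e' p' q'
joins-subst T refl refl refl j = j

joins-sym : ∀ T {e p q} → Joins T e p q → Joins T e q p
joins-sym T (inj₁ (a , b)) = inj₂ (a , b)
joins-sym T (inj₂ (a , b)) = inj₁ (a , b)

joins-incidentˡ : ∀ T e {p q} → Joins T e p q → Incident T e p
joins-incidentˡ T e (inj₁ (a , _)) = inj₁ a
joins-incidentˡ T e (inj₂ (_ , b)) = inj₂ b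

joins-incidentʳ : ∀ T e {p q} → Joins T e p q → Incident T e q
joins-incidentʳ T e (inj₁ (_ , b)) = inj₂ b
joins-incidentʳ T e (inj₂ (a , _)) = inj₁ a

incident-end : ∀ T e {p q x} → Joins T e p q → Incident T e x → x ≡ p ⊎ x ≡ q
incident-end T e (inj₁ (a , b)) (inj₁ c) = inj₁ (trans (sym c) a)
incident-end T e (inj₁ (a , b)) (inj₂ c) = inj₂ (trans (sym c) b)
incident-end T e (inj₂ (a , b)) (inj₁ c) = inj₂ (trans (sym c) a)
incident-end T e (inj₂ (a , b)) (inj₂ c) = inj₁ (trans (sym c) b)

other-end : ∀ T {e p q q'} → Joins T e p q → Joins T e p q' → q ≡ q'
other-end T (inj₁ (a , b)) (inj₁ (c , d)) = trans (sym b) d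
other-end T (inj₁ (a , b)) (inj₂ (c , d)) = trans (sym b) (trans d (trans (sym a) c))
other-end T (inj₂ (a , b)) (inj₁ (c , d)) = trans (sym a) (trans c (trans (sym b) d))
other-end T (inj₂ (a , b)) (inj₂ (c , d)) = trans (sym a) c

incident?-complete : ∀ H e x → Incident H e x → incident? H e x ≡ true
incident?-complete H e x (inj₁ p) = ∨-introˡ (==-complete p)
incident?-complete H e x (inj₂ p) = ∨-introʳ (src H e == x) (==-complete p)

incident?-sound : ∀ H e x → incident? H e x ≡ true → Incident H e x
incident?-sound H e x p with ∨-elim (src H e == x) p
... | inj₁ q = inj₁ (==-sound q)
... | inj₂ q = inj₂ (==-sound q)

-- a loop would be a closed walk of length one
acyclic-loopless : ∀ T → IsAcyclic T → ∀ e → src T e ≢ tgt T e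
acyclic-loopless T acyclic e p with acyclic (src T e) (e ∷ []) (cons e (inj₁ (refl , sym p)) nil) ([] ∷ [])
... | ()

fin-pos : ∀ {n} → Fin n → 0 < n
fin-pos zero    = s≤s z≤n
fin-pos (suc _) = s≤s z≤n

no-elements : ∀ {n} → n ≡ 0 → Fin n → ⊥
no-elements refl ()

zero-or-element : ∀ n → n ≡ 0 ⊎ Fin n
zero-or-element zero    = inj₁ refl
zero-or-element (suc n) = inj₂ zero

walk-first-edge : ∀ {G x y es} → Walk G x y es → x ≢ y → ∃ λ e → Incident G e x
walk-first-edge nil                        x≢y = ⊥-elim (x≢y refl)
walk-first-edge (cons e (inj₁ (p , _)) _) _   = e , inj₁ p
walk-first-edge (cons e (inj₂ (_ , p)) _) _   = e , inj₂ p

no-edges-walk : ∀ {G x y es} → nE G ≡ 0 → Walk G x y es → x ≡ y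
no-edges-walk _      nil          = refl
no-edges-walk noEdge (cons e _ _) = ⊥-elim (no-elements noEdge e)

edgeless-connected : ∀ G → IsConnected G → nE G ≡ 0 → nV G ≤ 1
edgeless-connected G (_ , conn) noEdge = bound (nV G) refl
  where
  distinct : ∀ {m n} (eq : m ≡ suc (suc n)) → subst Fin (sym eq) zero ≢ subst Fin (sym eq) (suc zero)
  distinct refl ()
  bound : ∀ n → nV G ≡ n → n ≤ 1
  bound zero          _  = z≤n
  bound (suc zero)    _  = s≤s z≤n
  bound (suc (suc n)) eq =
    ⊥-elim (distinct eq (no-edges-walk noEdge (proj₂ (conn (subst Fin (sym eq) zero) (subst Fin (sym eq) (suc zero))))))

incident-edge-or-alone : ∀ G → IsConnected G → ∀ x → (∃ λ e → Incident G e x) ⊎ (∀ y → y ≡ x)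
incident-edge-or-alone G (_ , conn) x with any? (λ y → ¬? (y ≟ x))
... | yes (y , y≢x) = inj₁ (walk-first-edge (proj₂ (conn x y)) (λ p → y≢x (sym p)))
... | no ∄y = inj₂ (λ y → decidable-stable (y ≟ x) (λ y≢x → ∄y (y , y≢x)))

module VertexDeletion {T : Graph} {v : Fin (nV T)} {T' : Graph} (ds : DeletesVertex T v T') where
  open DeletesVertex ds

  joins-restrict : ∀ f {a c} → Joins T (ιE f) (ιV a) (ιV c) → Joins T' f a c
  joins-restrict f (inj₁ (p , q)) = inj₁ (ιV-inj _ _ (trans (sym (ιE-src f)) p) , ιV-inj _ _ (trans (sym (ιE-tgt f)) q))
  joins-restrict f (inj₂ (p , q)) = inj₂ (ιV-inj _ _ (trans (sym (ιE-src f)) p) , ιV-inj _ _ (trans (sym (ιE-tgt f)) q))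

  joins-embed : ∀ f {a c} → Joins T' f a c → Joins T (ιE f) (ιV a) (ιV c)
  joins-embed f (inj₁ (p , q)) = inj₁ (trans (ιE-src f) (cong ιV p) , trans (ιE-tgt f) (cong ιV q))
  joins-embed f (inj₂ (p , q)) = inj₂ (trans (ιE-src f) (cong ιV p) , trans (ιE-tgt f) (cong ιV q))

  incident-embed : ∀ f {y} → Incident T' f y → Incident T (ιE f) (ιV y)
  incident-embed f (inj₁ p) = inj₁ (trans (ιE-src f) (cong ιV p))
  incident-embed f (inj₂ p) = inj₂ (trans (ιE-tgt f) (cong ιV p))

  avoids-v : ∀ f {p q} → Joins T f p q → p ≢ v → q ≢ v → ¬ Incident T f v
  avoids-v f j p≢v q≢v i with incident-end T f j i
  ... | inj₁ r = p≢v (sym r)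
  ... | inj₂ r = q≢v (sym r)

  map-walk : ∀ {a b es} → Walk T' a b es → Walk T (ιV a) (ιV b) (map ιE es)
  map-walk nil          = nil
  map-walk (cons f j w) = cons (ιE f) (joins-embed f j) (map-walk w)

  module _ (leaf : IsLeaf T v) where
    private
      eᵥ = proj₁ leaf
      eᵥ-loopless = proj₁ (proj₂ (proj₂ leaf))
      eᵥ-unique = proj₂ (proj₂ (proj₂ leaf))

    leaf-neighbour : ∃ λ u → u ≢ v
    leaf-neighbour with proj₁ (proj₂ leaf)
    ... | inj₁ p = tgt T eᵥ , λ q → eᵥ-loopless (trans p (sym q))
    ... | inj₂ p = src T eᵥ , λ q → eᵥ-loopless (trans q (sym p))

    -- A walk of T between surviving vertices can be shortened to avoid v: a visit to
    -- the leaf v enters and leaves along the same edge, so it can be cut out.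
    walk-restrict : ∀ {y z es} (a : Fin (nV T')) → ιV a ≡ y → (b : Fin (nV T')) → ιV b ≡ z
                  → Walk T y z es → ∃ λ es' → Walk T' a b es'
    walk-restrict a pa b pb nil =
      subst (λ b → ∃ λ es' → Walk T' a b es') (ιV-inj a b (trans pa (sym pb))) (_ , nil)
    walk-restrict a pa b pb (cons {y = y₁} f j w) with y₁ ≟ v
    ... | no y₁≢v with ιV-onto y₁ y₁≢v
    ...   | c , pc with ιE-onto f (avoids-v f j (λ q → ιV-avoid a (trans pa q)) y₁≢v)
    ...     | f' , pf with walk-restrict c pc b pb w
    ...       | es' , w' =
      f' ∷ es' , cons f' (joins-restrict f' (joins-subst T (sym pf) (sym pa) (sym pc) j)) w'
    walk-restrict a pa b pb (cons f j nil) | yes y₁≡v = ⊥-elim (ιV-avoid b (trans pb y₁≡v))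
    walk-restrict {y} a pa b pb (cons {y = y₁} f j (cons {y = y₂} f₂ j₂ w₂)) | yes y₁≡v =
      walk-restrict a (trans pa (other-end T (joins-sym T into-v) out-of-v)) b pb w₂
      where
      into-v : Joins T eᵥ y y₁
      into-v = joins-subst T (eᵥ-unique f (subst (Incident T f) y₁≡v (joins-incidentʳ T f j))) refl refl j
      out-of-v : Joins T eᵥ y₁ y₂
      out-of-v = joins-subst T (eᵥ-unique f₂ (subst (Incident T f₂) y₁≡v (joins-incidentˡ T f₂ j₂))) refl refl j₂

    tree-minus-leaf : IsTree T → IsTree T'
    tree-minus-leaf ((_ , conn) , acyclic) = connected , acyclic'
      where
      connected : IsConnected T'
      connected = fin-pos (proj₁ (ιV-onto (proj₁ leaf-neighbour) (proj₂ leaf-neighbour))) ,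
                  λ x y → walk-restrict x refl y refl (proj₂ (conn (ιV x) (ιV y)))
      empty-image : ∀ (es : List (Fin (nE T'))) → map ιE es ≡ [] → es ≡ []
      empty-image []      _ = refl
      empty-image (_ ∷ _) ()
      acyclic' : IsAcyclic T'
      acyclic' x es w u =
        empty-image es (acyclic (ιV x) (map ιE es) (map-walk w) (Unique.map⁺ (λ {a} {b} → ιE-inj a b) u))

VL : LGraph → Set
VL L = Fin (nV (graph L))

EL : LGraph → Set
EL L = Fin (nE (graph L))

sL : (L : LGraph) → EL L → VL L
sL L = src (graph L)

tL : (L : LGraph) → EL L → VL L
tL L = tgt (graph L)

original≢external : original ≢ external
original≢external ()

NotExternal : (L : LGraph) → VL L → Set
NotExternal L x = vkind L x ≢ external

subdiv-head-split : ∀ L e → tL (subdivideL L e) (suc e) ≡ zero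
subdiv-head-split L e = if-true (==-refl e)

subdiv-head-other : ∀ L e e₂ → e₂ ≢ e → tL (subdivideL L e) (suc e₂) ≡ suc (tL L e₂)
subdiv-head-other L e e₂ e₂≢e = if-false (==-false e₂≢e)

subdiv-new-external : ∀ L e → vkind (subdivideL L e) zero ≡ external → onGEdge L e ≡ false
subdiv-new-external L e p with onGEdge L e
subdiv-new-external L e () | true
... | false = refl

subdiv-new-not-external : ∀ L e → onGEdge L e ≡ true → NotExternal (subdivideL L e) zero
subdiv-new-not-external L e g ext with subdiv-new-external L e ext
... | g≡false = not-¬ g g≡false

gEdge-ends : ∀ {G L} → Refines G L → ∀ e → onGEdge L e ≡ true
           → NotExternal L (sL L e) × NotExternal L (tL L e)
gEdge-ends base e _ = (λ ()) , (λ ())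
gEdge-ends (subdiv {L} R e) zero g = subdiv-new-not-external L e g , proj₂ (gEdge-ends R e g)
gEdge-ends (subdiv {L} R e) (suc e₂) g with e₂ ≟ e
... | yes refl = proj₁ (gEdge-ends R e g) , subdiv-new-not-external L e g
... | no _     = gEdge-ends R e₂ g
gEdge-ends (attach R u) zero ()
gEdge-ends (attach R u) (suc e₂) g = gEdge-ends R e₂ g

-- Attached edges point away from G: their heads are external.
attached-head-external : ∀ {G L} → Refines G L → ∀ e → onGEdge L e ≡ false → vkind L (tL L e) ≡ external
attached-head-external base e ()
attached-head-external (subdiv R e) zero g = attached-head-external R e g
attached-head-external (subdiv {L} R e) (suc e₂) g with e₂ ≟ e
... | yes refl = new-kind (onGEdge L e) g
  where
  new-kind : ∀ b → b ≡ false → (if b then internal else external) ≡ external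
  new-kind false _ = refl
... | no _ = attached-head-external R e₂ g
attached-head-external (attach R u) zero     _ = refl
attached-head-external (attach R u) (suc e₂) g = attached-head-external R e₂ g

-- Distinct attached edges have distinct heads (each external vertex has one parent).
attached-heads-injective : ∀ {G L} → Refines G L → ∀ e₁ e₂ → onGEdge L e₁ ≡ false → onGEdge L e₂ ≡ false
                         → tL L e₁ ≡ tL L e₂ → e₁ ≡ e₂
attached-heads-injective base e₁ e₂ ()
attached-heads-injective (subdiv R e) zero zero _ _ _ = refl
attached-heads-injective (subdiv R e) zero (suc e₂) g₁ g₂ q with e₂ ≟ e
... | yes refl  = ⊥-elim (0≢1+n (sym q))
... | no e₂≢e = ⊥-elim (e₂≢e (sym (attached-heads-injective R e e₂ g₁ g₂ (suc-injective q))))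
attached-heads-injective (subdiv R e) (suc e₁) zero g₁ g₂ q with e₁ ≟ e
... | yes refl  = ⊥-elim (0≢1+n q)
... | no e₁≢e = ⊥-elim (e₁≢e (attached-heads-injective R e₁ e g₁ g₂ (suc-injective q)))
attached-heads-injective (subdiv R e) (suc e₁) (suc e₂) g₁ g₂ q with e₁ ≟ e | e₂ ≟ e
... | yes refl | yes refl = refl
... | yes refl | no _     = ⊥-elim (0≢1+n q)
... | no _     | yes refl = ⊥-elim (0≢1+n (sym q))
... | no _     | no _     = cong suc (attached-heads-injective R e₁ e₂ g₁ g₂ (suc-injective q))
attached-heads-injective (attach R u) zero     zero     _  _  _ = refl
attached-heads-injective (attach R u) zero     (suc e₂) _  _  ()
attached-heads-injective (attach R u) (suc e₁) zero     _  _  ()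
attached-heads-injective (attach R u) (suc e₁) (suc e₂) g₁ g₂ q =
  cong suc (attached-heads-injective R e₁ e₂ g₁ g₂ (suc-injective q))

original-vertex : ∀ {G L} → Refines G L → Fin (nV G) → ∃ λ x → vkind L x ≡ original
original-vertex base x = x , refl
original-vertex (subdiv R e) x₀ with original-vertex R x₀
... | x , p = suc x , p
original-vertex (attach R u) x₀ with original-vertex R x₀
... | x , p = suc x , p

edgeless-refinement : ∀ {G L} → Refines G L → nE (graph L) ≡ 0 → nV (graph L) ≡ nV G × nE G ≡ 0
edgeless-refinement base p = refl , p
edgeless-refinement (subdiv R e) ()
edgeless-refinement (attach R u) ()

HasIncidentEdges : LGraph → Set
HasIncidentEdges L = (∀ x → ∃ λ e → Incident (graph L) e x) ⊎ (nE (graph L) ≡ 0 × (∀ (x y : VL L) → x ≡ y))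

incident-shift : ∀ {G G' : Graph} {e x} {e' : Fin (nE G')} (f : Fin (nV G) → Fin (nV G'))
  → src G' e' ≡ f (src G e) → tgt G' e' ≡ f (tgt G e) → Incident G e x → Incident G' e' (f x)
incident-shift f p q (inj₁ r) = inj₁ (trans p (cong f r))
incident-shift f p q (inj₂ r) = inj₂ (trans q (cong f r))

has-incident-edges : ∀ {G L} → Refines G L → IsConnected G → HasIncidentEdges L
has-incident-edges {G} base conn with zero-or-element (nE G)
... | inj₂ e₀ = inj₁ at
  where
  at : ∀ x → ∃ λ e → Incident G e x
  at x with incident-edge-or-alone G conn x
  ... | inj₁ r     = r
  ... | inj₂ alone = e₀ , inj₁ (alone (src G e₀))
... | inj₁ noEdge = inj₂ (noEdge , same)
  where
  same : ∀ x y → x ≡ y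
  same x y with incident-edge-or-alone G conn y
  ... | inj₁ (e , _) = ⊥-elim (no-elements noEdge e)
  ... | inj₂ alone   = alone x
has-incident-edges (attach {L} R u) conn with has-incident-edges R conn
... | inj₁ at = inj₁ at'
  where
  at' : ∀ x → ∃ λ e → Incident (graph (attachL L u)) e x
  at' zero    = zero , inj₂ refl
  at' (suc x) with at x
  ... | e , i = suc e , incident-shift {graph L} {graph (attachL L u)} {e} {x} {suc e} suc refl refl i
... | inj₂ (_ , same) = inj₁ at'
  where
  at' : ∀ x → ∃ λ e → Incident (graph (attachL L u)) e x
  at' zero    = zero , inj₂ refl
  at' (suc x) = zero , inj₁ (cong suc (same u x))
has-incident-edges (subdiv {L} R e) conn with has-incident-edges R conn
... | inj₂ (noEdge , _) = ⊥-elim (no-elements noEdge e)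
... | inj₁ at = inj₁ at'
  where
  at' : ∀ x → ∃ λ h → Incident (graph (subdivideL L e)) h x
  at' zero = zero , inj₁ refl
  at' (suc x) with at x
  ... | e₂ , i with e₂ ≟ e
  ...   | no e₂≢e = suc e₂ , incident-shift {graph L} {graph (subdivideL L e)} {e₂} {x} {suc e₂}
                               suc refl (subdiv-head-other L e e₂ e₂≢e) i
  at' (suc x) | .e , inj₁ p | yes refl = suc e , inj₁ (cong suc p)
  at' (suc x) | .e , inj₂ p | yes refl = zero , inj₂ (cong suc p)

-- For a marking P of the vertices of a refinement L, `below R P x` holds when x is
-- marked or lies in a tree attached at a vertex with this property; it is computed by
-- recursion on the refinement, pulling the marking back along each step.

-- pull a marking back along a subdivision of e; the head of e inherits the mark of the
-- new vertex, so that the closure travels along the subdivided edge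
pull-subdiv : (L : LGraph) (e : EL L) → (VL (subdivideL L e) → Bool) → VL L → Bool
pull-subdiv L e P x = P (suc x) ∨ ((x == tL L e) ∧ P zero)

below : ∀ {G L} → Refines G L → (VL L → Bool) → VL L → Bool
below base P x = P x
below (attach R u) P zero             = below R (λ x → P (suc x)) u ∨ P zero
below (attach R u) P (suc x)          = below R (λ x → P (suc x)) x
below (subdiv {L} R e) P zero    = below R (pull-subdiv L e P) (sL L e) ∨ P zero
below (subdiv {L} R e) P (suc x) = below R (pull-subdiv L e P) x

AllExternal : (L : LGraph) → (VL L → Bool) → Set
AllExternal L P = ∀ x → P x ≡ true → vkind L x ≡ external

ClosedDownward : (L : LGraph) → (VL L → Bool) → Set
ClosedDownward L D = ∀ e → onGEdge L e ≡ false → D (sL L e) ≡ true → D (tL L e) ≡ true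

marked-below : ∀ {G L} (R : Refines G L) P x → P x ≡ true → below R P x ≡ true
marked-below base P x p = p
marked-below (attach R u) P zero    p = ∨-introʳ _ p
marked-below (attach R u) P (suc x) p = marked-below R _ x p
marked-below (subdiv R e) P zero    p = ∨-introʳ _ p
marked-below (subdiv R e) P (suc x) p = marked-below R _ x (∨-introˡ p)

pull-subdiv-external : ∀ {G L} → Refines G L → ∀ e P → AllExternal (subdivideL L e) P
                     → AllExternal L (pull-subdiv L e P)
pull-subdiv-external {L = L} R e P ext x q with ∨-elim (P (suc x)) q
... | inj₁ p = ext (suc x) p
... | inj₂ p = subst (λ z → vkind L z ≡ external) (sym (==-sound (∧-conicalˡ (x == tL L e) (P zero) p)))
                 (attached-head-external R e (subdiv-new-external L e (ext zero (∧-conicalʳ (x == tL L e) (P zero) p))))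

below-external : ∀ {G L} (R : Refines G L) P → AllExternal L P → AllExternal L (below R P)
below-external base P ext x p = ext x p
below-external (attach R u) P ext zero    p = refl
below-external (attach R u) P ext (suc x) p = below-external R _ (λ y → ext (suc y)) x p
below-external (subdiv {L} R e) P ext zero p with ∨-elim (below R (pull-subdiv L e P) (sL L e)) p
... | inj₂ q = ext zero q
... | inj₁ q with onGEdge L e in g
...   | true  = ⊥-elim (proj₁ (gEdge-ends R e g)
                  (below-external R _ (pull-subdiv-external R e P ext) (sL L e) q))
...   | false = refl
below-external (subdiv {L} R e) P ext (suc x) p = below-external R _ (pull-subdiv-external R e P ext) x p

below-closed : ∀ {G L} (R : Refines G L) P → AllExternal L P → ClosedDownward L (below R P)
below-closed base P ext e ()
below-closed (attach R u) P ext zero    g p = ∨-introˡ p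
below-closed (attach R u) P ext (suc e) g p = below-closed R _ (λ y → ext (suc y)) e g p
below-closed (subdiv {L} R e) P ext zero g p with ∨-elim (below R (pull-subdiv L e P) (sL L e)) p
... | inj₁ q = below-closed R _ (pull-subdiv-external R e P ext) e g q
... | inj₂ q = marked-below R _ (tL L e)
                 (∨-introʳ (P (suc (tL L e))) (subst (λ b → (b ∧ P zero) ≡ true) (sym (==-refl (tL L e))) q))
below-closed (subdiv {L} R e) P ext (suc e₂) g p with e₂ ≟ e
... | yes refl = ∨-introˡ {below R (pull-subdiv L e P) (sL L e)} {P zero} p
... | no _     = below-closed R _ (pull-subdiv-external R e P ext) e₂ g p

below-entered : ∀ {G L} (R : Refines G L) P → AllExternal L P → ∀ e → onGEdge L e ≡ false
              → below R P (tL L e) ≡ true → below R P (sL L e) ≡ true ⊎ P (tL L e) ≡ true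
below-entered base P ext e ()
below-entered (attach R u) P ext zero g p = ∨-elim (below R (λ x → P (suc x)) u) p
below-entered (attach R u) P ext (suc e) g p = below-entered R _ (λ y → ext (suc y)) e g p
below-entered (subdiv {L} R e) P ext zero g p with below-entered R _ (pull-subdiv-external R e P ext) e g p
... | inj₁ q = inj₁ (∨-introˡ q)
... | inj₂ q with ∨-elim (P (suc (tL L e))) q
...   | inj₁ r = inj₂ r
...   | inj₂ r = inj₁ (∨-introʳ (below R (pull-subdiv L e P) (sL L e)) (∧-conicalʳ (tL L e == tL L e) (P zero) r))
below-entered (subdiv {L} R e) P ext (suc e₂) g p with e₂ ≟ e
... | yes refl = ∨-elim (below R (pull-subdiv L e P) (sL L e)) p
... | no e₂≢e with below-entered R _ (pull-subdiv-external R e P ext) e₂ g p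
...   | inj₁ q = inj₁ q
...   | inj₂ q with ∨-elim (P (suc (tL L e₂))) q
...     | inj₁ r = inj₂ r
...     | inj₂ r = ⊥-elim (e₂≢e (attached-heads-injective R e₂ e g
                       (subdiv-new-external L e (ext zero (∧-conicalʳ (tL L e₂ == tL L e) (P zero) r)))
                       (==-sound (∧-conicalˡ (tL L e₂ == tL L e) (P zero) r))))

record Prunes (L : LGraph) (D : VL L → Bool) (L' : LGraph) : Set where
  field
    jV : VL L' → VL L
    jE : EL L' → EL L
    jV-inj : Injective _≡_ _≡_ jV
    jE-inj : Injective _≡_ _≡_ jE
    jV-live : ∀ x → D (jV x) ≡ false
    jV-onto : ∀ y → D y ≡ false → ∃ λ x → jV x ≡ y
    jE-onto : ∀ e → D (sL L e) ≡ false → D (tL L e) ≡ false → ∃ λ e' → jE e' ≡ e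
    jE-src : ∀ e' → sL L (jE e') ≡ jV (sL L' e')
    jE-tgt : ∀ e' → tL L (jE e') ≡ jV (tL L' e')

Pruning : Graph → (L : LGraph) → (VL L → Bool) → Set
Pruning G L D = Σ LGraph λ L' → Refines G L' × Prunes L D L'

-- Extending a vertex embedding j into Fin n to one into Fin (suc n), whose new vertex
-- zero is pruned (`suc ∘ j`) or survives (`lift 1 j`).
shift-onto : ∀ {m n} (D : Fin (suc n) → Bool) (j : Fin m → Fin n) → D zero ≡ true
  → (∀ y → D (suc y) ≡ false → ∃ λ x → j x ≡ y) → ∀ y → D y ≡ false → ∃ λ x → suc (j x) ≡ y
shift-onto D j dead onto zero    p = ⊥-elim (not-¬ dead p)
shift-onto D j dead onto (suc y) p with onto y p
... | x , q = x , cong suc q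

lift-live : ∀ {m n} (D : Fin (suc n) → Bool) (j : Fin m → Fin n) → D zero ≡ false
  → (∀ x → D (suc (j x)) ≡ false) → ∀ x → D (lift 1 j x) ≡ false
lift-live D j new-live live zero    = new-live
lift-live D j new-live live (suc x) = live x

lift-onto : ∀ {m n} (D : Fin (suc n) → Bool) (j : Fin m → Fin n)
  → (∀ y → D (suc y) ≡ false → ∃ λ x → j x ≡ y) → ∀ y → D y ≡ false → ∃ λ x → lift 1 j x ≡ y
lift-onto D j onto zero    _ = zero , refl
lift-onto D j onto (suc y) p with onto y p
... | x , q = suc x , cong suc q

-- G itself has no external vertices, so nothing is pruned.
prune-base : ∀ G (D : VL (baseL G) → Bool) → AllExternal (baseL G) D → Pruning G (baseL G) D
prune-base G D ext = baseL G , base , record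
  { jV = λ x → x ; jE = λ e → e ; jV-inj = λ p → p ; jE-inj = λ p → p
  ; jV-live = live ; jV-onto = λ y _ → y , refl ; jE-onto = λ e _ _ → e , refl
  ; jE-src = λ _ → refl ; jE-tgt = λ _ → refl }
  where
  live : ∀ x → D x ≡ false
  live x = ¬-not (λ p → original≢external (ext x p))

-- The attached leaf is pruned: the pruning of the smaller refinement still works.
prune-attach-dead : ∀ {G L L₀} u (D : VL (attachL L u) → Bool) → D zero ≡ true
  → Refines G L₀ → Prunes L (λ x → D (suc x)) L₀ → Pruning G (attachL L u) D
prune-attach-dead {L = L} {L₀} u D dead R₀ E₀ = L₀ , R₀ , record
  { jV = λ x → suc (jV x) ; jE = λ e → suc (jE e)
  ; jV-inj = λ p → jV-inj (suc-injective p) ; jE-inj = λ p → jE-inj (suc-injective p)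
  ; jV-live = jV-live ; jV-onto = shift-onto D jV dead jV-onto ; jE-onto = onto-E
  ; jE-src = λ e → cong suc (jE-src e) ; jE-tgt = λ e → cong suc (jE-tgt e) }
  where
  open Prunes E₀
  onto-E : ∀ e → D (sL (attachL L u) e) ≡ false → D (tL (attachL L u) e) ≡ false → ∃ λ e' → suc (jE e') ≡ e
  onto-E zero    _ q = ⊥-elim (not-¬ dead q)
  onto-E (suc e) p q with jE-onto e p q
  ... | x , r = x , cong suc r

-- The attached leaf survives, so its parent u does too: attach it to the copy of u.
prune-attach-live : ∀ {G L L₀} u (D : VL (attachL L u) → Bool) → D zero ≡ false → D (suc u) ≡ false
  → Refines G L₀ → Prunes L (λ x → D (suc x)) L₀ → Pruning G (attachL L u) D
prune-attach-live {L = L} {L₀} u D leaf-live u-live R₀ E₀ = attachL L₀ u' , attach R₀ u' , record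
  { jV = lift 1 jV ; jE = lift 1 jE
  ; jV-inj = lift-injective jV jV-inj 1 ; jE-inj = lift-injective jE jE-inj 1
  ; jV-live = lift-live D jV leaf-live jV-live ; jV-onto = lift-onto D jV jV-onto ; jE-onto = onto-E
  ; jE-src = ends-src ; jE-tgt = ends-tgt }
  where
  open Prunes E₀
  u' = proj₁ (jV-onto u u-live)
  onto-E : ∀ e → D (sL (attachL L u) e) ≡ false → D (tL (attachL L u) e) ≡ false → ∃ λ e' → lift 1 jE e' ≡ e
  onto-E zero    _ _ = zero , refl
  onto-E (suc e) p q with jE-onto e p q
  ... | x , r = suc x , cong suc r
  ends-src : ∀ e' → sL (attachL L u) (lift 1 jE e') ≡ lift 1 jV (sL (attachL L₀ u') e')
  ends-src zero    = cong suc (sym (proj₂ (jV-onto u u-live)))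
  ends-src (suc e) = cong suc (jE-src e)
  ends-tgt : ∀ e' → tL (attachL L u) (lift 1 jE e') ≡ lift 1 jV (tL (attachL L₀ u') e')
  ends-tgt zero    = refl
  ends-tgt (suc e) = cong suc (jE-tgt e)

prune-attach : ∀ {G L} u (D : VL (attachL L u) → Bool) → ClosedDownward (attachL L u) D
  → Pruning G L (λ x → D (suc x)) → Pruning G (attachL L u) D
prune-attach u D closed (L₀ , R₀ , E₀) with D zero in d
... | true  = prune-attach-dead u D d R₀ E₀
... | false = prune-attach-live u D d (¬-not (λ p → not-¬ (closed zero refl p) d)) R₀ E₀

-- The new vertex of the subdivided (attached) edge e = ab is pruned, hence so is b.
prune-subdiv-dead : ∀ {G L L₀} e (D : VL (subdivideL L e) → Bool)
  → AllExternal (subdivideL L e) D → ClosedDownward (subdivideL L e) D → D zero ≡ true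
  → Refines G L₀ → Prunes L (λ x → D (suc x)) L₀ → Pruning G (subdivideL L e) D
prune-subdiv-dead {L = L} {L₀} e D ext closed dead R₀ E₀ = L₀ , R₀ , record
  { jV = λ x → suc (jV x) ; jE = λ e → suc (jE e)
  ; jV-inj = λ p → jV-inj (suc-injective p) ; jE-inj = λ p → jE-inj (suc-injective p)
  ; jV-live = jV-live ; jV-onto = shift-onto D jV dead jV-onto ; jE-onto = onto-E
  ; jE-src = λ e → cong suc (jE-src e) ; jE-tgt = ends-tgt }
  where
  open Prunes E₀
  head-dead : D (suc (tL L e)) ≡ true
  head-dead = closed zero (subdiv-new-external L e (ext zero dead)) dead
  avoids-e : ∀ e' → jE e' ≢ e
  avoids-e e' p = not-¬ head-dead
    (subst (λ z → D (suc z) ≡ false) (trans (sym (jE-tgt e')) (cong (tL L) p)) (jV-live (tL L₀ e')))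
  onto-E : ∀ e₂ → D (sL (subdivideL L e) e₂) ≡ false → D (tL (subdivideL L e) e₂) ≡ false
         → ∃ λ e' → suc (jE e') ≡ e₂
  onto-E zero     p _ = ⊥-elim (not-¬ dead p)
  onto-E (suc e₂) p q with e₂ ≟ e
  ... | yes refl = ⊥-elim (not-¬ dead q)
  ... | no _ with jE-onto e₂ p q
  ...   | x , r = x , cong suc r
  ends-tgt : ∀ e' → tL (subdivideL L e) (suc (jE e')) ≡ suc (jV (tL L₀ e'))
  ends-tgt e' = trans (subdiv-head-other L e (jE e') (avoids-e e')) (cong suc (jE-tgt e'))

-- The whole subdivided edge e survives: subdivide its copy.
prune-subdiv-live : ∀ {G L L₀} e (D : VL (subdivideL L e) → Bool) → D zero ≡ false
  → D (suc (sL L e)) ≡ false → D (suc (tL L e)) ≡ false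
  → Refines G L₀ → Prunes L (λ x → D (suc x)) L₀ → Pruning G (subdivideL L e) D
prune-subdiv-live {L = L} {L₀} e D new-live tail-live head-live R₀ E₀ = subdivideL L₀ e' , subdiv R₀ e' , record
  { jV = lift 1 jV ; jE = lift 1 jE
  ; jV-inj = lift-injective jV jV-inj 1 ; jE-inj = lift-injective jE jE-inj 1
  ; jV-live = lift-live D jV new-live jV-live ; jV-onto = lift-onto D jV jV-onto ; jE-onto = onto-E
  ; jE-src = ends-src ; jE-tgt = ends-tgt }
  where
  open Prunes E₀
  e' = proj₁ (jE-onto e tail-live head-live)
  e'-copy : jE e' ≡ e
  e'-copy = proj₂ (jE-onto e tail-live head-live)
  onto-E : ∀ e₂ → D (sL (subdivideL L e) e₂) ≡ false → D (tL (subdivideL L e) e₂) ≡ false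
         → ∃ λ x → lift 1 jE x ≡ e₂
  onto-E zero     _ _ = zero , refl
  onto-E (suc e₂) p q with e₂ ≟ e
  ... | yes refl = suc e' , cong suc e'-copy
  ... | no _ with jE-onto e₂ p q
  ...   | x , r = suc x , cong suc r
  ends-src : ∀ x → sL (subdivideL L e) (lift 1 jE x) ≡ lift 1 jV (sL (subdivideL L₀ e') x)
  ends-src zero    = refl
  ends-src (suc x) = cong suc (jE-src x)
  ends-tgt : ∀ x → tL (subdivideL L e) (lift 1 jE x) ≡ lift 1 jV (tL (subdivideL L₀ e') x)
  ends-tgt zero = cong suc (trans (cong (tL L) (sym e'-copy)) (jE-tgt e'))
  ends-tgt (suc x) with x ≟ e'
  ... | yes refl = subst (λ z → tL (subdivideL L e) (suc z) ≡ zero) (sym e'-copy) (subdiv-head-split L e)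
  ... | no x≢e'  = trans (subdiv-head-other L e (jE x) (λ p → x≢e' (jE-inj (trans p (sym e'-copy)))))
                         (cong suc (jE-tgt x))

-- The subdivided edge e = ab is cut at its new vertex (b is pruned): the surviving half
-- becomes a leaf attached at the copy of a.
prune-subdiv-cut : ∀ {G L L₀} e (D : VL (subdivideL L e) → Bool) → D zero ≡ false
  → D (suc (sL L e)) ≡ false → D (suc (tL L e)) ≡ true
  → Refines G L₀ → Prunes L (λ x → D (suc x)) L₀ → Pruning G (subdivideL L e) D
prune-subdiv-cut {L = L} {L₀} e D new-live tail-live head-dead R₀ E₀ = attachL L₀ a' , attach R₀ a' , record
  { jV = lift 1 jV ; jE = jE'
  ; jV-inj = lift-injective jV jV-inj 1 ; jE-inj = jE'-inj
  ; jV-live = lift-live D jV new-live jV-live ; jV-onto = lift-onto D jV jV-onto ; jE-onto = onto-E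
  ; jE-src = ends-src ; jE-tgt = ends-tgt }
  where
  open Prunes E₀
  a' = proj₁ (jV-onto (sL L e) tail-live)
  avoids-e : ∀ x → jE x ≢ e
  avoids-e x p = not-¬ head-dead
    (subst (λ z → D (suc z) ≡ false) (trans (sym (jE-tgt x)) (cong (tL L) p)) (jV-live (tL L₀ x)))
  -- the new leaf edge is the first half of e
  jE' : EL (attachL L₀ a') → EL (subdivideL L e)
  jE' zero    = suc e
  jE' (suc x) = suc (jE x)
  jE'-inj : Injective _≡_ _≡_ jE'
  jE'-inj {zero}  {zero}  _ = refl
  jE'-inj {zero}  {suc y} p = ⊥-elim (avoids-e y (sym (suc-injective p)))
  jE'-inj {suc x} {zero}  p = ⊥-elim (avoids-e x (suc-injective p))
  jE'-inj {suc x} {suc y} p = cong suc (jE-inj (suc-injective p))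
  onto-E : ∀ e₂ → D (sL (subdivideL L e) e₂) ≡ false → D (tL (subdivideL L e) e₂) ≡ false
         → ∃ λ x → jE' x ≡ e₂
  onto-E zero     _ q = ⊥-elim (not-¬ head-dead q)
  onto-E (suc e₂) p q with e₂ ≟ e
  ... | yes refl = zero , refl
  ... | no _ with jE-onto e₂ p q
  ...   | x , r = suc x , cong suc r
  ends-src : ∀ x → sL (subdivideL L e) (jE' x) ≡ lift 1 jV (sL (attachL L₀ a') x)
  ends-src zero    = cong suc (sym (proj₂ (jV-onto (sL L e) tail-live)))
  ends-src (suc x) = cong suc (jE-src x)
  ends-tgt : ∀ x → tL (subdivideL L e) (jE' x) ≡ lift 1 jV (tL (attachL L₀ a') x)
  ends-tgt zero    = subdiv-head-split L e
  ends-tgt (suc x) = trans (subdiv-head-other L e (jE x) (avoids-e x)) (cong suc (jE-tgt x))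

closed-pull-subdiv : ∀ L e (D : VL (subdivideL L e) → Bool) → ClosedDownward (subdivideL L e) D
                   → ClosedDownward L (λ x → D (suc x))
closed-pull-subdiv L e D closed e₂ g p with e₂ ≟ e
... | yes refl = closed zero g (subst (λ z → D z ≡ true) (subdiv-head-split L e) (closed (suc e) g p))
... | no e₂≢e  = subst (λ z → D z ≡ true) (subdiv-head-other L e e₂ e₂≢e) (closed (suc e₂) g p)

subdiv-tail-live : ∀ {G L} → Refines G L → ∀ e (D : VL (subdivideL L e) → Bool)
  → AllExternal (subdivideL L e) D → ClosedDownward (subdivideL L e) D
  → D zero ≡ false → D (suc (sL L e)) ≡ false
subdiv-tail-live {L = L} R e D ext closed new-live = ¬-not tail-dead-absurd
  where
  tail-dead-absurd : D (suc (sL L e)) ≡ true → ⊥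
  tail-dead-absurd p with onGEdge L e in g
  ... | true  = proj₁ (gEdge-ends R e g) (ext (suc (sL L e)) p)
  ... | false = not-¬ (subst (λ z → D z ≡ true) (subdiv-head-split L e) (closed (suc e) g p)) new-live

prune-subdiv : ∀ {G L} → Refines G L → ∀ e (D : VL (subdivideL L e) → Bool)
  → AllExternal (subdivideL L e) D → ClosedDownward (subdivideL L e) D
  → Pruning G L (λ x → D (suc x)) → Pruning G (subdivideL L e) D
prune-subdiv {L = L} R e D ext closed (L₀ , R₀ , E₀) with D zero in d
... | true = prune-subdiv-dead e D ext closed d R₀ E₀
... | false with D (suc (tL L e)) in head
...   | false = prune-subdiv-live e D d (subdiv-tail-live R e D ext closed d) head R₀ E₀
...   | true  = prune-subdiv-cut e D d (subdiv-tail-live R e D ext closed d) head R₀ E₀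

prune : ∀ {G L} → Refines G L → (D : VL L → Bool) → AllExternal L D → ClosedDownward L D → Pruning G L D
prune {G} base D ext _ = prune-base G D ext
prune (attach R u) D ext closed =
  prune-attach u D closed (prune R (λ x → D (suc x)) (λ x → ext (suc x)) (λ e → closed (suc e)))
prune (subdiv {L} R e) D ext closed =
  prune-subdiv R e D ext closed
    (prune R (λ x → D (suc x)) (λ x → ext (suc x)) (closed-pull-subdiv L e D closed))

degree-constant : ∀ k (f : Fin k → ℕ) n c → (∀ e → f e ≡ c) → Fin k → degAux k f n ≡ c
degree-constant (suc k) f n c h _ = h zero

degree-bounded : ∀ k (f : Fin k → ℕ) n c → (∀ e → f e ≤ c) → (k ≡ 0 → n ≤ c) → degAux k f n ≤ c
degree-bounded zero    f n c _ edgeless = edgeless refl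
degree-bounded (suc k) f n c h _        = h zero

module Harmonic {H T : Graph} (φ : FHM H T) where

  image-incident : ∀ h x → Incident H h x → Incident T (φE φ h) (φV φ x)
  image-incident h x (inj₁ p) = subst (Incident T (φE φ h)) (cong (φV φ) p) (joins-incidentˡ T _ (preserves φ h))
  image-incident h x (inj₂ p) = subst (Incident T (φE φ h)) (cong (φV φ) p) (joins-incidentʳ T _ (preserves φ h))

  -- Local surjectivity: at a vertex x with some edge, every edge at φ(x) is the image of
  -- an edge at x, since harmonicity makes all multiplicities at x equal and positive.
  edge-over : IsHarmonic φ → ∀ x → (∃ λ h → Incident H h x)
            → ∀ e' → Incident T e' (φV φ x) → ∃ λ h → Incident H h x × φE φ h ≡ e'
  edge-over harmonic x (h , h-at-x) e' e'-at-φx with sum-pos (nE H) _ mult-pos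
    where
    mult-pos : 0 < mult φ x e'
    mult-pos = <-≤-trans (r-pos φ h) (begin
      r φ h                   ≡⟨ sym (if-true (subst (λ b → (b ∧ (φE φ h == φE φ h)) ≡ true)
                                   (sym (incident?-complete H h x h-at-x)) (==-refl (φE φ h)))) ⟩
      _                       ≤⟨ sum-term (nE H) h _ ⟩
      mult φ x (φE φ h)       ≡⟨ harmonic x (φE φ h) e' (image-incident h x h-at-x) e'-at-φx ⟩
      mult φ x e'             ∎)
      where open ≤-Reasoning
  ... | h₁ , p with if-positive _ _ p
  ...   | q = h₁ , incident?-sound H h₁ x (∧-conicalˡ _ _ q) , ==-sound (∧-conicalʳ _ _ q)

  module _ (harmonic : IsHarmonic φ) (loopless : ∀ e → src T e ≢ tgt T e) where

    fibre-sum : Fin (nV T) → Fin (nE T) → ℕ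
    fibre-sum y e = sumFin (nV H) (λ x → if φV φ x == y then mult φ x e else 0)

    contribution : Fin (nV T) → Fin (nE T) → Fin (nE H) → Fin (nV H) → ℕ
    contribution y e h x = if φV φ x == y then (if incident? H h x ∧ (φE φ h == e) then r φ h else 0) else 0

    contribution-zero : ∀ y e h x → (φV φ x == y) ≡ false ⊎ incident? H h x ≡ false ⊎ (φE φ h == e) ≡ false
                      → contribution y e h x ≡ 0
    contribution-zero y e h x = nested-if-zero (φV φ x == y) (incident? H h x) (φE φ h == e) (r φ h)

    -- the two ends of an edge have distinct images, as the target has no loops
    distinct-ends : ∀ h → φV φ (src H h) ≢ φV φ (tgt H h)
    distinct-ends h p with preserves φ h
    ... | inj₁ (a , b) = loopless (φE φ h) (trans a (trans p (sym b)))
    ... | inj₂ (a , b) = loopless (φE φ h) (trans a (trans (sym p) (sym b)))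

    end-over : ∀ {e y} h → φE φ h ≡ e → Incident T e y
      → ∃ λ x₀ → Incident H h x₀ × φV φ x₀ ≡ y × (∀ x → x ≢ x₀ → Incident H h x → φV φ x ≢ y)
    end-over {e} {y} h refl y-at-e with incident-end T e (preserves φ h) y-at-e
    ... | inj₁ y≡s = src H h , inj₁ refl , sym y≡s , other
      where
      other : ∀ x → x ≢ src H h → Incident H h x → φV φ x ≢ y
      other x x≢s (inj₁ p) _ = x≢s (sym p)
      other x x≢s (inj₂ p) q = distinct-ends h (trans (sym y≡s) (trans (sym q) (cong (φV φ) (sym p))))
    ... | inj₂ y≡t = tgt H h , inj₂ refl , sym y≡t , other
      where
      other : ∀ x → x ≢ tgt H h → Incident H h x → φV φ x ≢ y
      other x x≢t (inj₁ p) q = distinct-ends h (trans (cong (φV φ) p) (trans q y≡t))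
      other x x≢t (inj₂ p) _ = x≢t (sym p)

    edge-contribution : ∀ y e → Incident T e y → ∀ h
      → sumFin (nV H) (contribution y e h) ≡ (if φE φ h == e then r φ h else 0)
    edge-contribution y e y-at-e h = by-cases (φE φ h ≟ e)
      where
      by-cases : Dec (φE φ h ≡ e) → sumFin (nV H) (contribution y e h) ≡ (if φE φ h == e then r φ h else 0)
      by-cases (no h≢e) =
        trans (sum-zeros (nV H) (λ x → contribution-zero y e h x (inj₂ (inj₂ (==-false h≢e)))))
              (sym (if-false (==-false h≢e)))
      by-cases (yes h↦e) with end-over h h↦e y-at-e
      ... | x₀ , x₀-at-h , x₀↦y , others =
        trans (sum-single (nV H) x₀ (contribution y e h) zero-elsewhere)
              (trans (nested-if-one (r φ h) (==-complete x₀↦y) (incident?-complete H h x₀ x₀-at-h) (==-complete h↦e))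
                     (sym (if-true (==-complete h↦e))))
        where
        zero-elsewhere : ∀ x → x ≢ x₀ → contribution y e h x ≡ 0
        zero-elsewhere x x≢x₀ = by-incidence (incident? H h x) refl
          where
          by-incidence : ∀ b → incident? H h x ≡ b → contribution y e h x ≡ 0
          by-incidence false at = contribution-zero y e h x (inj₂ (inj₁ at))
          by-incidence true  at = contribution-zero y e h x
                                    (inj₁ (==-false (others x x≢x₀ (incident?-sound H h x at))))

    preSum-fibre : ∀ y e → Incident T e y → preSum φ e ≡ fibre-sum y e
    preSum-fibre y e y-at-e = sym (begin
      fibre-sum y e                                              ≡⟨ sum-ext (nV H) (λ x → sum-if (nE H) (φV φ x == y) _) ⟩
      sumFin (nV H) (λ x → sumFin (nE H) (λ h → contribution y e h x)) ≡⟨ sum-swap (nV H) (nE H) _ ⟩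
      sumFin (nE H) (λ h → sumFin (nV H) (contribution y e h))   ≡⟨ sum-ext (nE H) (edge-contribution y e y-at-e) ⟩
      preSum φ e                                                 ∎)
      where open ≡-Reasoning

    fibre-sum-harmonic : ∀ y e e' → Incident T e y → Incident T e' y → fibre-sum y e ≡ fibre-sum y e'
    fibre-sum-harmonic y e e' e-at-y e'-at-y = sum-ext (nV H) at
      where
      at : ∀ x → (if φV φ x == y then mult φ x e else 0) ≡ (if φV φ x == y then mult φ x e' else 0)
      at x with φV φ x == y in over
      ... | false = refl
      ... | true  = harmonic x e e' (subst (Incident T e) (sym (==-sound over)) e-at-y)
                                    (subst (Incident T e') (sym (==-sound over)) e'-at-y)

    preSum-adjacent : ∀ y e e' → Incident T e y → Incident T e' y → preSum φ e ≡ preSum φ e'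
    preSum-adjacent y e e' e-at-y e'-at-y =
      trans (preSum-fibre y e e-at-y) (trans (fibre-sum-harmonic y e e' e-at-y e'-at-y) (sym (preSum-fibre y e' e'-at-y)))

    preSum-walk : ∀ {y z es} → Walk T y z es → ∀ e e' → Incident T e y → Incident T e' z → preSum φ e ≡ preSum φ e'
    preSum-walk nil          e e' e-at-y e'-at-z = preSum-adjacent _ e e' e-at-y e'-at-z
    preSum-walk (cons f j w) e e' e-at-y e'-at-z =
      trans (preSum-adjacent _ e f e-at-y (joins-incidentˡ T f j)) (preSum-walk w f e' (joins-incidentʳ T f j) e'-at-z)

    preSum-constant : IsConnected T → ∀ e e' → preSum φ e ≡ preSum φ e'
    preSum-constant (_ , conn) e e' = preSum-walk (proj₂ (conn (src T e) (src T e'))) e e' (inj₁ refl) (inj₁ refl)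

module Restriction (G : Graph) (G-connected : IsConnected G) (L : LGraph) (R : Refines G L)
                   (T : Graph) (T-tree : IsTree T) (φ : FHM (graph L) T) (harmonic : IsHarmonic φ)
                   (v : Fin (nV T)) (leaf : IsLeaf T v)
                   (over-v-external : ∀ x → φV φ x ≡ v → vkind L x ≡ external)
                   (T' : Graph) (ds : DeletesVertex T v T') where
  open DeletesVertex ds
  open VertexDeletion ds
  open Harmonic φ

  H : Graph
  H = graph L

  T'-tree : IsTree T'
  T'-tree = tree-minus-leaf leaf T-tree

  over-v : VL L → Bool
  over-v x = φV φ x == v

  D : VL L → Bool
  D = below R over-v

  over-v-external' : AllExternal L over-v
  over-v-external' x p = over-v-external x (==-sound p)

  D-external : AllExternal L D
  D-external = below-external R over-v over-v-external'

  D-closed : ClosedDownward L D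
  D-closed = below-closed R over-v over-v-external'

  pruned : Pruning G L D
  pruned = prune R D D-external D-closed

  L' : LGraph
  L' = proj₁ pruned

  R' : Refines G L'
  R' = proj₁ (proj₂ pruned)

  H' : Graph
  H' = graph L'

  open Prunes (proj₂ (proj₂ pruned))

  leaving-edge : ∀ h → D (src H h) ≡ false → D (tgt H h) ≡ true → φV φ (tgt H h) ≡ v
  leaving-edge h tail-live head-dead with onGEdge L h in g
  ... | true  = ⊥-elim (proj₂ (gEdge-ends R h g) (D-external _ head-dead))
  ... | false with below-entered R over-v over-v-external' h g head-dead
  ...   | inj₁ tail-dead = ⊥-elim (not-¬ tail-dead tail-live)
  ...   | inj₂ over      = ==-sound over

  no-entering-edge : ∀ h → D (tgt H h) ≡ false → D (src H h) ≡ true → ⊥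
  no-entering-edge h head-live tail-dead with onGEdge L h in g
  ... | true  = proj₁ (gEdge-ends R h g) (D-external _ tail-dead)
  ... | false = not-¬ (D-closed h g tail-dead) head-live

  live-not-over-v : ∀ x → D x ≡ false → φV φ x ≢ v
  live-not-over-v x live over = not-¬ (marked-below R over-v x (==-complete over)) live

  -- The restricted map: surviving vertices and edges avoid v, so they have copies in T'.
  φV'-exists : ∀ x' → ∃ λ y → ιV y ≡ φV φ (jV x')
  φV'-exists x' = ιV-onto _ (live-not-over-v (jV x') (jV-live x'))

  φV' : VL L' → Fin (nV T')
  φV' x' = proj₁ (φV'-exists x')

  φV'-spec : ∀ x' → ιV (φV' x') ≡ φV φ (jV x')
  φV'-spec x' = proj₂ (φV'-exists x')

  src-live : ∀ h' → D (src H (jE h')) ≡ false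
  src-live h' = subst (λ z → D z ≡ false) (sym (jE-src h')) (jV-live _)

  tgt-live : ∀ h' → D (tgt H (jE h')) ≡ false
  tgt-live h' = subst (λ z → D z ≡ false) (sym (jE-tgt h')) (jV-live _)

  φE'-exists : ∀ h' → ∃ λ f → ιE f ≡ φE φ (jE h')
  φE'-exists h' = ιE-onto _ (avoids-v _ (preserves φ (jE h'))
                              (live-not-over-v _ (src-live h')) (live-not-over-v _ (tgt-live h')))

  φE' : EL L' → Fin (nE T')
  φE' h' = proj₁ (φE'-exists h')

  φE'-spec : ∀ h' → ιE (φE' h') ≡ φE φ (jE h')
  φE'-spec h' = proj₂ (φE'-exists h')

  φ'-preserves : ∀ h' → Joins T' (φE' h') (φV' (src H' h')) (φV' (tgt H' h'))
  φ'-preserves h' = joins-restrict _ (joins-subst T (sym (φE'-spec h'))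
                      (trans (cong (φV φ) (jE-src h')) (sym (φV'-spec _)))
                      (trans (cong (φV φ) (jE-tgt h')) (sym (φV'-spec _)))
                      (preserves φ (jE h')))

  -- every vertex of H has an edge: otherwise H is a point and φ could not be surjective
  -- onto the two ends of the leaf edge
  vertex-has-edge : ∀ x → ∃ λ h → Incident H h x
  vertex-has-edge with has-incident-edges R G-connected
  ... | inj₁ at = at
  ... | inj₂ (_ , all-equal) = ⊥-elim (proj₂ (leaf-neighbour leaf)
          (trans (sym (proj₂ over-u)) (trans (cong (φV φ) (all-equal _ _)) (proj₂ over-v'))))
    where
    over-v' = surjective φ v
    over-u  = surjective φ (proj₁ (leaf-neighbour leaf))

  -- Walks of T' lift to the surviving part of H: a surviving vertex over a can be moved
  -- along an edge ac of T' to a surviving vertex over c, by local surjectivity.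
  lift-step : ∀ x → D x ≡ false → ∀ f {a c} → Joins T' f a c → ιV a ≡ φV φ x
            → ∃ λ w → D w ≡ false × ιV c ≡ φV φ w
  lift-step x x-live f {a} {c} j a↦x
    with edge-over harmonic x (vertex-has-edge x) (ιE f)
           (subst (Incident T (ιE f)) a↦x (joins-incidentˡ T _ (joins-embed f j)))
  ... | h , inj₁ s≡x , h↦f = tgt H h , head-live , c↦t
    where
    c↦t : ιV c ≡ φV φ (tgt H h)
    c↦t = other-end T (joins-subst T refl a↦x refl (joins-embed f j))
                      (joins-subst T h↦f (cong (φV φ) s≡x) refl (preserves φ h))
    head-live : D (tgt H h) ≡ false
    head-live = ¬-not (λ head-dead → ιV-avoid c (trans c↦t
                  (leaving-edge h (subst (λ u → D u ≡ false) (sym s≡x) x-live) head-dead)))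
  ... | h , inj₂ t≡x , h↦f = src H h , tail-live , c↦s
    where
    c↦s : ιV c ≡ φV φ (src H h)
    c↦s = other-end T (joins-subst T refl a↦x refl (joins-embed f j))
                      (joins-subst T h↦f (cong (φV φ) t≡x) refl (joins-sym T (preserves φ h)))
    tail-live : D (src H h) ≡ false
    tail-live = ¬-not (no-entering-edge h (subst (λ u → D u ≡ false) (sym t≡x) x-live))

  lift-walk : ∀ {a c es} → Walk T' a c es → ∀ x → D x ≡ false → ιV a ≡ φV φ x
            → ∃ λ w → D w ≡ false × ιV c ≡ φV φ w
  lift-walk nil          x x-live a↦x = x , x-live , a↦x
  lift-walk (cons f j w) x x-live a↦x with lift-step x x-live f j a↦x
  ... | x₂ , x₂-live , b↦x₂ = lift-walk w x₂ x₂-live b↦x₂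

  -- surjectivity: lift a walk of T' starting at the image of a surviving original vertex
  φ'-surjective : ∀ y → ∃ λ x' → φV' x' ≡ y
  φ'-surjective y = w' , ιV-inj _ _ (begin
      ιV (φV' w')    ≡⟨ φV'-spec w' ⟩
      φV φ (jV w')   ≡⟨ cong (φV φ) (proj₂ w'-copy) ⟩
      φV φ w         ≡⟨ sym (proj₂ (proj₂ lifted)) ⟩
      ιV y           ∎)
    where
    open ≡-Reasoning
    x₀ = proj₁ (original-vertex R (fromℕ< (proj₁ G-connected)))
    x₀-live : D x₀ ≡ false
    x₀-live = ¬-not (λ p → original≢external (trans (sym (proj₂ (original-vertex R _))) (D-external x₀ p)))
    x₀-copy = jV-onto x₀ x₀-live
    lifted = lift-walk (proj₂ (proj₂ (proj₁ T'-tree) (φV' (proj₁ x₀-copy)) y)) x₀ x₀-live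
               (trans (φV'-spec _) (cong (φV φ) (proj₂ x₀-copy)))
    w = proj₁ lifted
    w'-copy = jV-onto w (proj₁ (proj₂ lifted))
    w' = proj₁ w'-copy

  φ' : FHM H' T'
  φ' = record
    { φV = φV' ; φE = φE' ; r = λ h' → r φ (jE h') ; r-pos = λ h' → r-pos φ (jE h')
    ; preserves = φ'-preserves ; surjective = φ'-surjective }

  incidence-copy : ∀ x' h' → incident? H (jE h') (jV x') ≡ incident? H' h' x'
  incidence-copy x' h' = cong₂ _∨_ (trans (cong (_== jV x') (jE-src h')) (==-injective jV jV-inj _ _))
                                   (trans (cong (_== jV x') (jE-tgt h')) (==-injective jV jV-inj _ _))

  image-copy : ∀ f h' → (φE φ (jE h') == ιE f) ≡ (φE' h' == f)
  image-copy f h' = trans (cong (_== ιE f) (sym (φE'-spec h'))) (==-injective ιE (λ {a} {b} → ιE-inj a b) _ _)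

  pruned-edge-not-over-T' : ∀ x' f h → Incident H h (jV x') → D (src H h) ≡ true ⊎ D (tgt H h) ≡ true
                          → φE φ h ≢ ιE f
  pruned-edge-not-over-T' x' f h (inj₁ s≡x) dead h↦f with dead
  ... | inj₁ tail-dead = not-¬ tail-dead (subst (λ z → D z ≡ false) (sym s≡x) (jV-live x'))
  ... | inj₂ head-dead = ιE-avoid f (subst (λ g → Incident T g v) h↦f
          (subst (Incident T (φE φ h)) (leaving-edge h (subst (λ z → D z ≡ false) (sym s≡x) (jV-live x')) head-dead)
                 (joins-incidentʳ T _ (preserves φ h))))
  pruned-edge-not-over-T' x' f h (inj₂ t≡x) dead h↦f with dead
  ... | inj₁ tail-dead = no-entering-edge h (subst (λ z → D z ≡ false) (sym t≡x) (jV-live x')) tail-dead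
  ... | inj₂ head-dead = not-¬ head-dead (subst (λ z → D z ≡ false) (sym t≡x) (jV-live x'))

  -- The multiplicities of φ' are those of φ at the copies: the edges at jV x' that are
  -- not copied go to the pruned part and contribute nothing over an edge of T'.
  φ'-mult : ∀ x' f → mult φ' x' f ≡ mult φ (jV x') (ιE f)
  φ'-mult x' f = trans (sum-ext (nE H') copied) (Reindex.reindex-≡ jE jE-inj F off-image)
    where
    F : EL L → ℕ
    F h = if incident? H h (jV x') ∧ (φE φ h == ιE f) then r φ h else 0
    copied : ∀ h' → (if incident? H' h' x' ∧ (φE' h' == f) then r φ (jE h') else 0) ≡ F (jE h')
    copied h' = cong₂ (λ b c → if b ∧ c then r φ (jE h') else 0) (sym (incidence-copy x' h')) (sym (image-copy f h'))
    vanishes : ∀ h → D (src H h) ≡ true ⊎ D (tgt H h) ≡ true → F h ≡ 0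
    vanishes h dead = by-incidence (incident? H h (jV x')) refl
      where
      by-incidence : ∀ b → incident? H h (jV x') ≡ b → F h ≡ 0
      by-incidence false at = if-∧-false (incident? H h (jV x')) (φE φ h == ιE f) (r φ h) (inj₁ at)
      by-incidence true  at = if-∧-false (incident? H h (jV x')) (φE φ h == ιE f) (r φ h)
        (inj₂ (==-false (pruned-edge-not-over-T' x' f h (incident?-sound H h (jV x') at) dead)))
    off-image : ∀ h → (∃ λ k → jE k ≡ h) ⊎ F h ≡ 0
    off-image h with D (src H h) in tail | D (tgt H h) in head
    ... | false | false = inj₁ (jE-onto h tail head)
    ... | true  | _     = inj₂ (vanishes h (inj₁ tail))
    ... | false | true  = inj₂ (vanishes h (inj₂ head))

  φ'-harmonic : IsHarmonic φ'
  φ'-harmonic x' f f' f-at f'-at = begin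
    mult φ' x' f               ≡⟨ φ'-mult x' f ⟩
    mult φ (jV x') (ιE f)      ≡⟨ harmonic (jV x') (ιE f) (ιE f')
                                    (subst (Incident T (ιE f)) (φV'-spec x') (incident-embed f f-at))
                                    (subst (Incident T (ιE f')) (φV'-spec x') (incident-embed f' f'-at)) ⟩
    mult φ (jV x') (ιE f')     ≡⟨ sym (φ'-mult x' f') ⟩
    mult φ' x' f'              ∎
    where open ≡-Reasoning

  φ'-preSum-≤ : ∀ f → preSum φ' f ≤ preSum φ (ιE f)
  φ'-preSum-≤ f = ≤-trans (≤-reflexive (sum-ext (nE H') copied)) (Reindex.reindex-≤ jE jE-inj F)
    where
    F : EL L → ℕ
    F h = if φE φ h == ιE f then r φ h else 0
    copied : ∀ h' → (if φE' h' == f then r φ (jE h') else 0) ≡ F (jE h')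
    copied h' = cong (λ b → if b then r φ (jE h') else 0) (sym (image-copy f h'))

  -- The degree: the index sum over the leaf edge, which is the index sum over every edge.
  eᵥ : Fin (nE T)
  eᵥ = proj₁ leaf

  preSum-at-leaf : ∀ e → preSum φ e ≡ preSum φ eᵥ
  preSum-at-leaf e = preSum-constant harmonic (acyclic-loopless T (proj₂ T-tree)) (proj₁ T-tree) e eᵥ

  degree-φ : degree φ ≡ preSum φ eᵥ
  degree-φ = degree-constant (nE T) (preSum φ) (nV H) _ preSum-at-leaf eᵥ

  -- a preimage of v has an edge, which lies over the leaf edge
  degree-positive : 1 ≤ preSum φ eᵥ
  degree-positive = ≤-trans (r-pos φ h) (≤-trans (≤-reflexive (sym (if-true (==-complete h↦eᵥ)))) (sum-term (nE H) h _))
    where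
    x = proj₁ (surjective φ v)
    h = proj₁ (vertex-has-edge x)
    h↦eᵥ : φE φ h ≡ eᵥ
    h↦eᵥ = proj₂ (proj₂ (proj₂ leaf)) _
             (subst (Incident T (φE φ h)) (proj₂ (surjective φ v)) (image-incident h x (proj₂ (vertex-has-edge x))))

  -- if T' has no edges, neither does H', so H' = G is a single vertex
  edgeless-degree : nE T' ≡ 0 → nV H' ≤ preSum φ eᵥ
  edgeless-degree T'-edgeless with zero-or-element (nE H')
  ... | inj₂ h' = ⊥-elim (no-elements T'-edgeless (φE' h'))
  ... | inj₁ H'-edgeless = ≤-trans (subst (_≤ 1) (sym (proj₁ (edgeless-refinement R' H'-edgeless)))
                                     (edgeless-connected G G-connected (proj₂ (edgeless-refinement R' H'-edgeless))))
                                   degree-positive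

  φ'-degree : degree φ' ≤ degree φ
  φ'-degree = ≤-trans (degree-bounded (nE T') (preSum φ') (nV H') _
                        (λ f → ≤-trans (φ'-preSum-≤ f) (≤-reflexive (preSum-at-leaf (ιE f))))
                        edgeless-degree)
                      (≤-reflexive (sym degree-φ))

mainTheorem3 : (G : Graph) → IsConnected G
    → (L : LGraph) → Refines G L
    → (T : Graph) → IsTree T
    → (φ : FHM (graph L) T) → IsHarmonic φ
    → IsSgon G (degree φ)
    → (v : Fin (nV T)) → IsLeaf T v
    → (∀ x → φV φ x ≡ v → vkind L x ≡ external)
    → (T' : Graph) → DeletesVertex T v T'
    → Transformation G φ T'
mainTheorem3 G G-connected L R T T-tree φ harmonic _ v leaf over-v-external T' ds =
  L' , R' , T'-tree , φ' , φ'-harmonic , φ'-degree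
  where
  open Restriction G G-connected L R T T-tree φ harmonic v leaf over-v-external T' ds
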